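{- For every integer $n\ge1$, $$T_n(x;p,q)=\sum_{k=0}^{n}\sum_{m=0}^{k-1}\sum_{\ell=0}^{n-k}\sum_{i=m}^{k-1}\sum_{j=\ell}^{n-k}\binom{i}{m}\binom{j}{\ell}(-1)^{m+\ell}\,s(n,n-j)\,S(n-j,k)\,s(k,k-i)\,p^m q^\ell x^k .$$
   Context: For a parameter $q\neq1$ let $\exp_q(t)=(1+(1-q)t)^{1/(1-q)}$, and let $\exp_1(t)=e^t$; this is regarded as a formal power series in $t$ whose coefficients are polynomials in $q$. The $p,q$-deformed Touchard polynomials $T_n(x;p,q)$ are defined by $\exp_p\big(x(\exp_q(t)-1)\big)=\sum_{n\ge0}T_n(x;p,q)\,t^n/n!$. Here $s(a,b)$ denotes the (signed) Stirling number of the first kind and $S(a,b)$ the Stirling number of the second kind; empty sums are $0$. -}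

module Defs where

open import Data.Nat as ℕ using (ℕ; zero; suc; _!)
open import Data.Nat.Properties using (_!≢0)
open import Data.Nat.Combinatorics using (_C_)
open import Data.Integer as ℤ using (ℤ; +_)
open import Data.Rational using (ℚ; _+_; _*_; _-_; -_; _/_; 0ℚ; 1ℚ; 1/_; ≢-nonZero)
open import Data.Rational.Properties using (_≟_)
open import Relation.Nullary using (yes; no)

_^ℚ_ : ℚ → ℕ → ℚ
a ^ℚ zero  = 1ℚ
a ^ℚ suc n = a * (a ^ℚ n)

ℕ→ℚ : ℕ → ℚ
ℕ→ℚ n = (+ n) / 1

ℤ→ℚ : ℤ → ℚ
ℤ→ℚ z = z / 1

-- Half-open range sum:  Σ_{i=a}^{b-1} f i   (empty, = 0, when b ≤ a)
sumFrom : ℕ → ℕ → (ℕ → ℚ) → ℚ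
sumFrom a zero    f = 0ℚ
sumFrom a (suc b) f with a ℕ.≤? b
... | yes _ = sumFrom a b f + f b
... | no  _ = 0ℚ

sumTo : ℕ → (ℕ → ℚ) → ℚ
sumTo n f = sumFrom 0 (suc n) f

s₁ : ℕ → ℕ → ℤ
s₁ zero    zero    = + 1
s₁ zero    (suc k) = + 0
s₁ (suc n) zero    = + 0
s₁ (suc n) (suc k) = s₁ n k ℤ.- (+ n) ℤ.* s₁ n (suc k)

S₂ : ℕ → ℕ → ℕ
S₂ zero    zero    = 1
S₂ zero    (suc k) = 0
S₂ (suc n) zero    = 0
S₂ (suc n) (suc k) = S₂ n k ℕ.+ suc k ℕ.* S₂ n (suc k)

-- Formal power series in t with rational coefficients: n ↦ [t^n]

Series : Set
Series = ℕ → ℚ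

_⊛_ : Series → Series → Series
(f ⊛ g) n = sumTo n (λ i → f i * g (n ℕ.∸ i))

_^ˢ_ : Series → ℕ → Series
f ^ˢ zero  = λ { zero → 1ℚ ; (suc _) → 0ℚ }
f ^ˢ suc k = f ⊛ (f ^ˢ k)

1/n! : ℕ → ℚ
1/n! n = (+ 1 / (n !)) {{n !≢0}}

fallingℚ : ℚ → ℕ → ℚ
fallingℚ α zero    = 1ℚ
fallingℚ α (suc n) = fallingℚ α n * (α - ℕ→ℚ n)

gbinom : ℚ → ℕ → ℚ
gbinom α n = fallingℚ α n * 1/n! n

-- exp_q(t) = (1 + (1-q) t)^{1/(1-q)} as a formal power series (binomial
-- series), and exp_1(t) = e^t.
expq : ℚ → Series
expq q n with q ≟ 1ℚ
... | yes _ = 1/n! n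
... | no q≢1 with (1ℚ - q) ≟ 0ℚ
...   | yes _ = 0ℚ  -- impossible branch (1 - q ≠ 0 when q ≠ 1)
...   | no  c≢0 = gbinom ((1/ (1ℚ - q)) {{≢-nonZero c≢0}}) n * ((1ℚ - q) ^ℚ n)

-- Composition F(G(t)) of series, for G with zero constant term:
-- [t^n] F(G) = Σ_{k=0}^{n} F_k [t^n] G^k
compose : Series → Series → Series
compose F G n = sumTo n (λ k → F k * (G ^ˢ k) n)

-- exp_p( x (exp_q(t) - 1) )
touchardGF : ℚ → ℚ → ℚ → Series
touchardGF x p q = compose (expq p) (λ { zero → 0ℚ ; (suc m) → x * expq q (suc m) })

T : ℕ → ℚ → ℚ → ℚ → ℚ
T n x p q = ℕ→ℚ (n !) * touchardGF x p q n

rhs : ℕ → ℚ → ℚ → ℚ → ℚ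
rhs n x p q =
  sumTo n λ k →
  sumFrom 0 k λ m →
  sumFrom 0 (suc (n ℕ.∸ k)) λ ℓ →
  sumFrom m k λ i →
  sumFrom ℓ (suc (n ℕ.∸ k)) λ j →
    ℕ→ℚ (i C m) * ℕ→ℚ (j C ℓ) * ((- 1ℚ) ^ℚ (m ℕ.+ ℓ))
    * ℤ→ℚ (s₁ n (n ℕ.∸ j)) * ℕ→ℚ (S₂ (n ℕ.∸ j) k) * ℤ→ℚ (s₁ k (k ℕ.∸ i))
    * (p ^ℚ m) * (q ^ℚ ℓ) * (x ^ℚ k)

module Submission where

open import Defs
open import Data.Nat as ℕ using (ℕ; zero; suc; _!; z≤n; s≤s; _<_; _≤_)
import Data.Nat.Properties as ℕP
open import Data.Nat.Combinatorics using (_C_; nCk+nC[k+1]≡[n+1]C[k+1]; k>n⇒nCk≡0)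
open import Data.Integer as ℤ using (+_)
import Data.Integer.Properties as ℤP
open import Data.Rational as Q using (ℚ; _+_; _*_; _-_; -_; _/_; 0ℚ; 1ℚ; 1/_; fromℚᵘ)
open import Data.Rational.Unnormalised as U using (mkℚᵘ; *≡*)
import Data.Rational.Unnormalised.Properties as UP
open import Data.Rational.Properties as QP using (_≟_)
open import Data.Rational.Solver using (module +-*-Solver)
open import Relation.Binary.PropositionalEquality
open import Relation.Nullary using (yes; no)
open import Data.Empty using (⊥-elim)
open +-*-Solver

-- fromℚᵘ respects the ring operations (it is a section of toℚᵘ up to ≃).
fromℚᵘ-homo-+ : ∀ a b → fromℚᵘ (a U.+ b) ≡ fromℚᵘ a + fromℚᵘ b
fromℚᵘ-homo-+ a b = QP.toℚᵘ-injective (UP.≃-trans (QP.toℚᵘ-fromℚᵘ (a U.+ b))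
  (UP.≃-trans (UP.+-cong (UP.≃-sym (QP.toℚᵘ-fromℚᵘ a)) (UP.≃-sym (QP.toℚᵘ-fromℚᵘ b)))
    (UP.≃-sym (QP.toℚᵘ-homo-+ (fromℚᵘ a) (fromℚᵘ b)))))

fromℚᵘ-homo-* : ∀ a b → fromℚᵘ (a U.* b) ≡ fromℚᵘ a * fromℚᵘ b
fromℚᵘ-homo-* a b = QP.toℚᵘ-injective (UP.≃-trans (QP.toℚᵘ-fromℚᵘ (a U.* b))
  (UP.≃-trans (UP.*-cong (UP.≃-sym (QP.toℚᵘ-fromℚᵘ a)) (UP.≃-sym (QP.toℚᵘ-fromℚᵘ b)))
    (UP.≃-sym (QP.toℚᵘ-homo-* (fromℚᵘ a) (fromℚᵘ b)))))

fromℚᵘ-homo-neg : ∀ a → fromℚᵘ (U.- a) ≡ - fromℚᵘ a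
fromℚᵘ-homo-neg a = QP.toℚᵘ-injective (UP.≃-trans (QP.toℚᵘ-fromℚᵘ (U.- a))
  (UP.≃-trans (UP.-‿cong (UP.≃-sym (QP.toℚᵘ-fromℚᵘ a)))
    (UP.≃-sym (QP.toℚᵘ-homo‿- (fromℚᵘ a)))))

-- ℤ→ℚ a is definitionally fromℚᵘ (mkℚᵘ a 0).
ℤ→ℚ-homo-+ : ∀ a b → ℤ→ℚ (a ℤ.+ b) ≡ ℤ→ℚ a + ℤ→ℚ b
ℤ→ℚ-homo-+ a b =
  trans (QP.fromℚᵘ-cong {mkℚᵘ (a ℤ.+ b) 0} {mkℚᵘ a 0 U.+ mkℚᵘ b 0} (*≡* unit-denominators))
        (fromℚᵘ-homo-+ (mkℚᵘ a 0) (mkℚᵘ b 0))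
  where
  unit-denominators : (a ℤ.+ b) ℤ.* + 1 ≡ (a ℤ.* + 1 ℤ.+ b ℤ.* + 1) ℤ.* + 1
  unit-denominators = cong (ℤ._* + 1) (sym (cong₂ ℤ._+_ (ℤP.*-identityʳ a) (ℤP.*-identityʳ b)))

ℤ→ℚ-homo-* : ∀ a b → ℤ→ℚ (a ℤ.* b) ≡ ℤ→ℚ a * ℤ→ℚ b
ℤ→ℚ-homo-* a b = trans (QP.fromℚᵘ-cong {mkℚᵘ (a ℤ.* b) 0} {mkℚᵘ a 0 U.* mkℚᵘ b 0} (*≡* refl))
                        (fromℚᵘ-homo-* (mkℚᵘ a 0) (mkℚᵘ b 0))

ℤ→ℚ-homo-− : ∀ a b → ℤ→ℚ (a ℤ.- b) ≡ ℤ→ℚ a - ℤ→ℚ b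
ℤ→ℚ-homo-− a b = trans (ℤ→ℚ-homo-+ a (ℤ.- b)) (cong (λ v → ℤ→ℚ a + v) (fromℚᵘ-homo-neg (mkℚᵘ b 0)))

ℕ→ℚ-homo-+ : ∀ a b → ℕ→ℚ (a ℕ.+ b) ≡ ℕ→ℚ a + ℕ→ℚ b
ℕ→ℚ-homo-+ a b = trans (cong ℤ→ℚ (ℤP.pos-+ a b)) (ℤ→ℚ-homo-+ (+ a) (+ b))

ℕ→ℚ-homo-* : ∀ a b → ℕ→ℚ (a ℕ.* b) ≡ ℕ→ℚ a * ℕ→ℚ b
ℕ→ℚ-homo-* a b = trans (cong ℤ→ℚ (ℤP.pos-* a b)) (ℤ→ℚ-homo-* (+ a) (+ b))

ℕ→ℚ-split : ∀ i n → i ≤ n → ℕ→ℚ n ≡ ℕ→ℚ i + ℕ→ℚ (n ℕ.∸ i)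
ℕ→ℚ-split i n i≤n = trans (cong ℕ→ℚ (sym (ℕP.m+[n∸m]≡n i≤n))) (ℕ→ℚ-homo-+ i (n ℕ.∸ i))

1/d*d≡1 : ∀ d .{{_ : ℕ.NonZero d}} → ((+ 1) / d) * ℕ→ℚ d ≡ 1ℚ
1/d*d≡1 (suc d) = QP.toℚᵘ-injective
  (UP.≃-trans (QP.toℚᵘ-homo-* ((+ 1) / suc d) (ℕ→ℚ (suc d)))
  (UP.≃-trans (UP.*-cong (QP.toℚᵘ-fromℚᵘ (mkℚᵘ (+ 1) d)) (QP.toℚᵘ-fromℚᵘ (mkℚᵘ (+ (suc d)) 0)))
  (*≡* cross-multiplied)))
  where
  cross-multiplied : (+ 1 ℤ.* + suc d) ℤ.* + 1 ≡ + 1 ℤ.* + (suc d ℕ.* 1)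
  cross-multiplied = trans (ℤP.*-identityʳ _) (trans (ℤP.*-identityˡ _)
    (sym (trans (ℤP.*-identityˡ _) (cong +_ (ℕP.*-identityʳ (suc d))))))

1/n!*n!≡1 : ∀ n → 1/n! n * ℕ→ℚ (n !) ≡ 1ℚ
1/n!*n!≡1 n = 1/d*d≡1 (n !) {{n ℕP.!≢0}}

[1+i]/[1+i]!≡1/i! : ∀ i → ℕ→ℚ (suc i) * 1/n! (suc i) ≡ 1/n! i
[1+i]/[1+i]!≡1/i! i = begin
  s * u                                   ≡⟨ solve 4 (λ s u v F → s :* u := s :* u :* (v :* F) :+ s :* u :* (con 1ℚ :- v :* F)) refl s u v F ⟩
  s * u * (v * F) + s * u * (1ℚ - v * F)  ≡⟨ cong (λ w → s * u * (v * F) + s * u * (1ℚ - w)) (1/n!*n!≡1 i) ⟩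
  s * u * (v * F) + s * u * (1ℚ - 1ℚ)     ≡⟨ solve 4 (λ s u v F → s :* u :* (v :* F) :+ s :* u :* (con 1ℚ :- con 1ℚ) := (u :* (s :* F)) :* v) refl s u v F ⟩
  (u * (s * F)) * v                       ≡⟨ cong (λ w → (u * w) * v) (sym (ℕ→ℚ-homo-* (suc i) (i !))) ⟩
  (u * ℕ→ℚ (suc i !)) * v                 ≡⟨ cong (_* v) (1/n!*n!≡1 (suc i)) ⟩
  1ℚ * v                                  ≡⟨ QP.*-identityˡ v ⟩
  v                                       ∎
  where
  open ≡-Reasoning
  s = ℕ→ℚ (suc i)
  u = 1/n! (suc i)
  v = 1/n! i
  F = ℕ→ℚ (i !)

Σ : ℕ → (ℕ → ℚ) → ℚ
Σ zero    f = 0ℚ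
Σ (suc n) f = Σ n f + f n

sumFrom0≡Σ : ∀ n f → sumFrom 0 n f ≡ Σ n f
sumFrom0≡Σ zero    f = refl
sumFrom0≡Σ (suc n) f with 0 ℕ.≤? n
... | yes _ = cong (_+ f n) (sumFrom0≡Σ n f)
... | no 0≰n = ⊥-elim (0≰n z≤n)

sumFrom≡Σ-shifted : ∀ m k f → sumFrom m k f ≡ Σ (k ℕ.∸ m) (λ t → f (m ℕ.+ t))
sumFrom≡Σ-shifted zero    zero    f = refl
sumFrom≡Σ-shifted (suc m) zero    f = refl
sumFrom≡Σ-shifted m       (suc b) f with m ℕ.≤? b
... | yes m≤b rewrite ℕP.+-∸-assoc 1 m≤b =
  cong₂ _+_ (sumFrom≡Σ-shifted m b f) (cong f (sym (ℕP.m+[n∸m]≡n m≤b)))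
... | no m≰b rewrite ℕP.m≤n⇒m∸n≡0 (ℕP.≰⇒> m≰b) = refl

Σ-cong : ∀ n {f g} → (∀ i → i < n → f i ≡ g i) → Σ n f ≡ Σ n g
Σ-cong zero    f≡g = refl
Σ-cong (suc n) f≡g = cong₂ _+_ (Σ-cong n (λ i i<n → f≡g i (ℕP.m<n⇒m<1+n i<n))) (f≡g n (ℕP.n<1+n n))

Σ-cong′ : ∀ n {f g} → (∀ i → f i ≡ g i) → Σ n f ≡ Σ n g
Σ-cong′ n f≡g = Σ-cong n (λ i _ → f≡g i)

Σ-zero : ∀ n {f} → (∀ i → i < n → f i ≡ 0ℚ) → Σ n f ≡ 0ℚ
Σ-zero zero    f≡0 = refl
Σ-zero (suc n) f≡0 = trans (cong₂ _+_ (Σ-zero n (λ i i<n → f≡0 i (ℕP.m<n⇒m<1+n i<n))) (f≡0 n (ℕP.n<1+n n)))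
                           (QP.+-identityʳ 0ℚ)

Σ-+ : ∀ n f g → Σ n (λ i → f i + g i) ≡ Σ n f + Σ n g
Σ-+ zero    f g = refl
Σ-+ (suc n) f g = trans (cong (_+ (f n + g n)) (Σ-+ n f g))
  (solve 4 (λ a b c d → (a :+ b) :+ (c :+ d) := (a :+ c) :+ (b :+ d)) refl (Σ n f) (Σ n g) (f n) (g n))

Σ-− : ∀ n f g → Σ n (λ i → f i - g i) ≡ Σ n f - Σ n g
Σ-− zero    f g = refl
Σ-− (suc n) f g = trans (cong (_+ (f n - g n)) (Σ-− n f g))
  (solve 4 (λ a b c d → (a :- b) :+ (c :- d) := (a :+ c) :- (b :+ d)) refl (Σ n f) (Σ n g) (f n) (g n))

Σ-*ˡ : ∀ n a f → Σ n (λ i → a * f i) ≡ a * Σ n f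
Σ-*ˡ zero    a f = sym (QP.*-zeroʳ a)
Σ-*ˡ (suc n) a f = trans (cong (_+ (a * f n)) (Σ-*ˡ n a f)) (sym (QP.*-distribˡ-+ a (Σ n f) (f n)))

Σ-*ʳ : ∀ n a f → Σ n (λ i → f i * a) ≡ Σ n f * a
Σ-*ʳ n a f = trans (Σ-cong′ n (λ i → QP.*-comm (f i) a)) (trans (Σ-*ˡ n a f) (QP.*-comm a (Σ n f)))

Σ-first : ∀ n f → Σ (suc n) f ≡ f 0 + Σ n (λ i → f (suc i))
Σ-first zero    f = trans (QP.+-identityˡ (f 0)) (sym (QP.+-identityʳ (f 0)))
Σ-first (suc n) f = trans (cong (_+ f (suc n)) (Σ-first n f)) (QP.+-assoc (f 0) _ _)

Σ-split : ∀ a b f → Σ (a ℕ.+ b) f ≡ Σ a f + Σ b (λ i → f (a ℕ.+ i))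
Σ-split a zero    f rewrite ℕP.+-identityʳ a = sym (QP.+-identityʳ _)
Σ-split a (suc b) f rewrite ℕP.+-suc a b =
  trans (cong (_+ f (a ℕ.+ b)) (Σ-split a b f)) (QP.+-assoc (Σ a f) _ _)

Σ-reverse : ∀ n f → Σ n f ≡ Σ n (λ i → f (n ℕ.∸ suc i))
Σ-reverse zero    f = refl
Σ-reverse (suc n) f = trans (QP.+-comm (Σ n f) (f n))
  (trans (cong (λ w → f n + w) (Σ-reverse n f)) (sym (Σ-first n (λ i → f (suc n ℕ.∸ suc i)))))

Σ-triangle : ∀ K (F : ℕ → ℕ → ℚ) →
  Σ K (λ m → Σ (K ℕ.∸ m) (λ t → F m (m ℕ.+ t))) ≡ Σ K (λ i → Σ (suc i) (λ m → F m i))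
Σ-triangle zero    F = refl
Σ-triangle (suc K) F = begin
  Σ (suc K) (λ m → Σ (suc K ℕ.∸ m) (λ t → F m (m ℕ.+ t)))
    ≡⟨ Σ-cong (suc K) row-extends ⟩
  Σ (suc K) (λ m → row m + F m K)
    ≡⟨ Σ-+ (suc K) row (λ m → F m K) ⟩
  (Σ K row + row K) + Σ (suc K) (λ m → F m K)
    ≡⟨ cong₂ (λ u v → (u + v) + Σ (suc K) (λ m → F m K)) (Σ-triangle K F) last-row-empty ⟩
  (Σ K (λ i → Σ (suc i) (λ m → F m i)) + 0ℚ) + Σ (suc K) (λ m → F m K)
    ≡⟨ cong (_+ Σ (suc K) (λ m → F m K)) (QP.+-identityʳ (Σ K (λ i → Σ (suc i) (λ m → F m i)))) ⟩
  Σ K (λ i → Σ (suc i) (λ m → F m i)) + Σ (suc K) (λ m → F m K) ∎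
  where
  open ≡-Reasoning
  row : ℕ → ℚ
  row m = Σ (K ℕ.∸ m) (λ t → F m (m ℕ.+ t))
  last-row-empty : row K ≡ 0ℚ
  last-row-empty rewrite ℕP.n∸n≡0 K = refl
  row-extends : ∀ m → m < suc K → Σ (suc K ℕ.∸ m) (λ t → F m (m ℕ.+ t)) ≡ row m + F m K
  row-extends m (s≤s m≤K) rewrite ℕP.+-∸-assoc 1 m≤K = cong (λ z → row m + F m z) (ℕP.m+[n∸m]≡n m≤K)

^-+ : ∀ a m l → a ^ℚ (m ℕ.+ l) ≡ a ^ℚ m * a ^ℚ l
^-+ a zero    l = sym (QP.*-identityˡ _)
^-+ a (suc m) l = trans (cong (a *_) (^-+ a m l)) (sym (QP.*-assoc a _ _))

[-1]^m*p^m≡[-p]^m : ∀ m p → (- 1ℚ) ^ℚ m * p ^ℚ m ≡ (- p) ^ℚ m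
[-1]^m*p^m≡[-p]^m zero    p = refl
[-1]^m*p^m≡[-p]^m (suc m) p =
  trans (solve 3 (λ a b p → (:- con 1ℚ :* a) :* (p :* b) := (:- p) :* (a :* b)) refl ((- 1ℚ) ^ℚ m) (p ^ℚ m) p)
        (cong ((- p) *_) ([-1]^m*p^m≡[-p]^m m p))

binomial-theorem : ∀ i y → Σ (suc i) (λ m → ℕ→ℚ (i C m) * y ^ℚ m) ≡ (1ℚ + y) ^ℚ i
binomial-theorem zero    y = refl
binomial-theorem (suc i) y = begin
  Σ (suc (suc i)) (λ m → ℕ→ℚ (suc i C m) * y ^ℚ m)
    ≡⟨ Σ-first (suc i) _ ⟩
  ℕ→ℚ (suc i C 0) * 1ℚ + Σ (suc i) (λ m → ℕ→ℚ (suc i C suc m) * (y * y ^ℚ m))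
    ≡⟨ cong (λ w → 1ℚ + w) (Σ-cong′ (suc i) pascal) ⟩
  1ℚ + Σ (suc i) (λ m → y * b m + b (suc m))
    ≡⟨ cong (λ w → 1ℚ + w) (trans (Σ-+ (suc i) _ _) (cong (_+ shifted) (Σ-*ˡ (suc i) y b))) ⟩
  1ℚ + (y * Σ (suc i) b + shifted)
    ≡⟨ solve 3 (λ y a b → con 1ℚ :+ (y :* a :+ b) := y :* a :+ (con 1ℚ :+ b)) refl y (Σ (suc i) b) shifted ⟩
  y * Σ (suc i) b + (1ℚ + shifted)
    ≡⟨ cong (λ v → y * Σ (suc i) b + v) unshift ⟩
  y * Σ (suc i) b + Σ (suc i) b
    ≡⟨ cong (λ v → y * v + v) (binomial-theorem i y) ⟩
  y * (1ℚ + y) ^ℚ i + (1ℚ + y) ^ℚ i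
    ≡⟨ solve 2 (λ y a → y :* a :+ a := (con 1ℚ :+ y) :* a) refl y ((1ℚ + y) ^ℚ i) ⟩
  (1ℚ + y) ^ℚ suc i ∎
  where
  open ≡-Reasoning
  b : ℕ → ℚ
  b m = ℕ→ℚ (i C m) * y ^ℚ m
  shifted : ℚ
  shifted = Σ (suc i) (λ m → b (suc m))
  pascal : ∀ m → ℕ→ℚ (suc i C suc m) * (y * y ^ℚ m) ≡ y * b m + b (suc m)
  pascal m = trans (cong (λ v → ℕ→ℚ v * (y * y ^ℚ m)) (sym (nCk+nC[k+1]≡[n+1]C[k+1] i m)))
    (trans (cong (_* (y * y ^ℚ m)) (ℕ→ℚ-homo-+ (i C m) (i C suc m)))
      (solve 4 (λ a b y t → (a :+ b) :* (y :* t) := y :* (a :* t) :+ b :* (y :* t)) refl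
        (ℕ→ℚ (i C m)) (ℕ→ℚ (i C suc m)) y (y ^ℚ m)))
  top-vanishes : b (suc i) ≡ 0ℚ
  top-vanishes rewrite k>n⇒nCk≡0 (ℕP.n<1+n i) = QP.*-zeroˡ (y ^ℚ suc i)
  unshift : 1ℚ + shifted ≡ Σ (suc i) b
  unshift = trans (sym (Σ-first (suc i) b)) (trans (cong (λ w → Σ (suc i) b + w) top-vanishes) (QP.+-identityʳ _))

alternating-binomial : ∀ i p z → Σ (suc i) (λ m → ℕ→ℚ (i C m) * ((- 1ℚ) ^ℚ m * p ^ℚ m) * z) ≡ (1ℚ - p) ^ℚ i * z
alternating-binomial i p z =
  trans (Σ-cong′ (suc i) (λ m → cong (λ v → ℕ→ℚ (i C m) * v * z) ([-1]^m*p^m≡[-p]^m m p)))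
        (trans (Σ-*ʳ (suc i) z _) (cong (_* z) (binomial-theorem i (- p))))

sQ : ℕ → ℕ → ℚ
sQ n N = ℤ→ℚ (s₁ n N)

SQ : ℕ → ℕ → ℚ
SQ N k = ℕ→ℚ (S₂ N k)

s₁-vanishes : ∀ n N → n < N → s₁ n N ≡ + 0
s₁-vanishes zero    (suc N) _ = refl
s₁-vanishes (suc n) (suc N) (s≤s n<N)
  rewrite s₁-vanishes n N n<N | s₁-vanishes n (suc N) (ℕP.m<n⇒m<1+n n<N) | ℤP.*-zeroʳ (+ n) = refl

S₂-vanishes : ∀ N k → N < k → S₂ N k ≡ 0
S₂-vanishes zero    (suc k) _ = refl
S₂-vanishes (suc N) (suc k) (s≤s N<k)
  rewrite S₂-vanishes N k N<k | S₂-vanishes N (suc k) (ℕP.m<n⇒m<1+n N<k) | ℕP.*-zeroʳ k = refl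

sQ-rec : ∀ n N → sQ (suc n) (suc N) ≡ sQ n N - ℕ→ℚ n * sQ n (suc N)
sQ-rec n N = trans (ℤ→ℚ-homo-− (s₁ n N) (+ n ℤ.* s₁ n (suc N)))
                   (cong (λ v → sQ n N - v) (ℤ→ℚ-homo-* (+ n) (s₁ n (suc N))))

SQ-rec : ∀ N k → SQ (suc N) (suc k) ≡ SQ N k + ℕ→ℚ (suc k) * SQ N (suc k)
SQ-rec N k = trans (ℕ→ℚ-homo-+ (S₂ N k) (suc k ℕ.* S₂ N (suc k)))
                   (cong (λ v → SQ N k + v) (ℕ→ℚ-homo-* (suc k) (S₂ N (suc k))))

n*sQ[n,0]≡0 : ∀ n → ℕ→ℚ n * sQ n 0 ≡ 0ℚ
n*sQ[n,0]≡0 zero    = refl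
n*sQ[n,0]≡0 (suc n) = QP.*-zeroʳ (ℕ→ℚ (suc n))

sTransform : ℚ → ℕ → (ℕ → ℚ) → ℚ
sTransform c n F = Σ (suc n) (λ N → sQ n N * F N * c ^ℚ (n ℕ.∸ N))

sTransform-tail : ∀ c n F →
  Σ (suc n) (λ N → sQ n (suc N) * F (suc N) * c ^ℚ (n ℕ.∸ N))
    ≡ c * (sTransform c n F - sQ n 0 * F 0 * c ^ℚ n)
sTransform-tail c n F = begin
  Σ (suc n) tail
    ≡⟨ cong₂ _+_ (trans (Σ-cong n pull-c) (Σ-*ˡ n c tail′)) last-vanishes ⟩
  c * Σ n tail′ + 0ℚ
    ≡⟨ solve 3 (λ c a w → c :* a :+ con 0ℚ := c :* (w :+ a :- w)) refl c (Σ n tail′) w₀ ⟩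
  c * (w₀ + Σ n tail′ - w₀)
    ≡⟨ cong (λ v → c * (v - w₀)) (sym (Σ-first n _)) ⟩
  c * (sTransform c n F - w₀) ∎
  where
  open ≡-Reasoning
  w₀ = sQ n 0 * F 0 * c ^ℚ n
  tail : ℕ → ℚ
  tail N = sQ n (suc N) * F (suc N) * c ^ℚ (n ℕ.∸ N)
  tail′ : ℕ → ℚ
  tail′ N = sQ n (suc N) * F (suc N) * c ^ℚ (n ℕ.∸ suc N)
  pull-c : ∀ N → N < n → tail N ≡ c * tail′ N
  pull-c N N<n rewrite ℕP.+-∸-assoc 1 N<n =
    solve 4 (λ a f c e → a :* f :* (c :* e) := c :* (a :* f :* e)) refl (sQ n (suc N)) (F (suc N)) c (c ^ℚ (n ℕ.∸ suc N))
  last-vanishes : tail n ≡ 0ℚ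
  last-vanishes rewrite s₁-vanishes n (suc n) (ℕP.n<1+n n) =
    trans (cong (_* c ^ℚ (n ℕ.∸ n)) (QP.*-zeroˡ (F (suc n)))) (QP.*-zeroˡ (c ^ℚ (n ℕ.∸ n)))

-- The step relation of the transform, inherited from s(n+1,N+1) = s(n,N) - n s(n,N+1):
--   sTransform c (n+1) F = sTransform c n (F ∘ suc) - n c · sTransform c n F.
sTransform-step : ∀ c n F → sTransform c (suc n) F ≡ sTransform c n (λ N → F (suc N)) - ℕ→ℚ n * c * sTransform c n F
sTransform-step c n F = begin
  sTransform c (suc n) F
    ≡⟨ Σ-first (suc n) _ ⟩
  sQ (suc n) 0 * F 0 * c ^ℚ suc n + Σ (suc n) (λ N → sQ (suc n) (suc N) * F (suc N) * c ^ℚ (n ℕ.∸ N))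
    ≡⟨ cong₂ _+_ first-vanishes (Σ-cong′ (suc n) expand) ⟩
  0ℚ + Σ (suc n) (λ N → sQ n N * F (suc N) * c ^ℚ (n ℕ.∸ N) - ℕ→ℚ n * tail N)
    ≡⟨ trans (QP.+-identityˡ _) (trans (Σ-− (suc n) _ _) (cong (λ v → A - v) (Σ-*ˡ (suc n) (ℕ→ℚ n) tail))) ⟩
  A - ℕ→ℚ n * Σ (suc n) tail
    ≡⟨ cong (λ v → A - ℕ→ℚ n * v) (sTransform-tail c n F) ⟩
  A - ℕ→ℚ n * (c * (B - sQ n 0 * F 0 * c ^ℚ n))
    ≡⟨ solve 7 (λ A n c B s f e → A :- n :* (c :* (B :- s :* f :* e)) := A :- n :* c :* B :+ (n :* s) :* (f :* e :* c))
         refl A (ℕ→ℚ n) c B (sQ n 0) (F 0) (c ^ℚ n) ⟩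
  A - ℕ→ℚ n * c * B + (ℕ→ℚ n * sQ n 0) * (F 0 * c ^ℚ n * c)
    ≡⟨ cong (λ v → A - ℕ→ℚ n * c * B + v * (F 0 * c ^ℚ n * c)) (n*sQ[n,0]≡0 n) ⟩
  A - ℕ→ℚ n * c * B + 0ℚ * (F 0 * c ^ℚ n * c)
    ≡⟨ trans (cong (λ v → A - ℕ→ℚ n * c * B + v) (QP.*-zeroˡ (F 0 * c ^ℚ n * c))) (QP.+-identityʳ _) ⟩
  A - ℕ→ℚ n * c * B ∎
  where
  open ≡-Reasoning
  A = sTransform c n (λ N → F (suc N))
  B = sTransform c n F
  tail : ℕ → ℚ
  tail N = sQ n (suc N) * F (suc N) * c ^ℚ (n ℕ.∸ N)
  first-vanishes : sQ (suc n) 0 * F 0 * c ^ℚ suc n ≡ 0ℚ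
  first-vanishes = trans (cong (_* c ^ℚ suc n) (QP.*-zeroˡ (F 0))) (QP.*-zeroˡ (c ^ℚ suc n))
  expand : ∀ N → sQ (suc n) (suc N) * F (suc N) * c ^ℚ (n ℕ.∸ N)
               ≡ sQ n N * F (suc N) * c ^ℚ (n ℕ.∸ N) - ℕ→ℚ n * tail N
  expand N = trans (cong (λ v → v * F (suc N) * c ^ℚ (n ℕ.∸ N)) (sQ-rec n N))
    (solve 5 (λ a m b f e → (a :- m :* b) :* f :* e := a :* f :* e :- m :* (b :* f :* e)) refl
      (sQ n N) (ℕ→ℚ n) (sQ n (suc N)) (F (suc N)) (c ^ℚ (n ℕ.∸ N)))

-- The c-deformed factorial Π_{j<n} (1 - j c); it is n! [t^n] exp_{1-c}(t).
expCoeff : ℚ → ℕ → ℚ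
expCoeff c zero    = 1ℚ
expCoeff c (suc n) = (1ℚ - ℕ→ℚ n * c) * expCoeff c n

sTransform-one : ∀ c n → sTransform c n (λ _ → 1ℚ) ≡ expCoeff c n
sTransform-one c zero    = refl
sTransform-one c (suc n) = trans (sTransform-step c n (λ _ → 1ℚ))
  (trans (cong (λ v → v - ℕ→ℚ n * c * v) (sTransform-one c n))
    (solve 3 (λ e m c → e :- m :* c :* e := (con 1ℚ :- m :* c) :* e) refl (expCoeff c n) (ℕ→ℚ n) c))

Sᶜ : ℚ → ℕ → ℕ → ℚ
Sᶜ c n k = sTransform c n (λ N → SQ N k)

-- Sᶜ(n,0) = 0 for n ≥ 1, since S(N,0) = 0 for N ≥ 1 and s(n,0) = 0.
Sᶜ-n0 : ∀ c n → Sᶜ c (suc n) 0 ≡ 0ℚ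
Sᶜ-n0 c n = Σ-zero (suc (suc n)) S[N,0]-term
  where
  S[N,0]-term : ∀ N → N < suc (suc n) → sQ (suc n) N * SQ N 0 * c ^ℚ (suc n ℕ.∸ N) ≡ 0ℚ
  S[N,0]-term zero    _ = trans (cong (_* c ^ℚ suc n) (QP.*-zeroˡ (SQ 0 0))) (QP.*-zeroˡ (c ^ℚ suc n))
  S[N,0]-term (suc N) _ = trans (cong (_* c ^ℚ (n ℕ.∸ N)) (QP.*-zeroʳ (sQ (suc n) (suc N)))) (QP.*-zeroˡ (c ^ℚ (n ℕ.∸ N)))

-- Triangular recurrence  Sᶜ(n+1,k+1) = Sᶜ(n,k) + (k + 1 - n c) Sᶜ(n,k+1),
-- from the step relation and the recurrence of S.
Sᶜ-rec : ∀ c n k → Sᶜ c (suc n) (suc k) ≡ Sᶜ c n k + (ℕ→ℚ (suc k) - ℕ→ℚ n * c) * Sᶜ c n (suc k)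
Sᶜ-rec c n k = trans (sTransform-step c n (λ N → SQ N (suc k)))
  (trans (cong (λ v → v - ℕ→ℚ n * c * Sᶜ c n (suc k)) S-recurrence)
    (solve 5 (λ a s b n c → a :+ s :* b :- n :* c :* b := a :+ (s :- n :* c) :* b) refl
       (Sᶜ c n k) (ℕ→ℚ (suc k)) (Sᶜ c n (suc k)) (ℕ→ℚ n) c))
  where
  S-recurrence : sTransform c n (λ N → SQ (suc N) (suc k)) ≡ Sᶜ c n k + ℕ→ℚ (suc k) * Sᶜ c n (suc k)
  S-recurrence =
    trans (Σ-cong′ (suc n) (λ N → trans (cong (λ v → sQ n N * v * c ^ℚ (n ℕ.∸ N)) (SQ-rec N k))
            (solve 5 (λ a s t u e → a :* (s :+ t :* u) :* e := a :* s :* e :+ t :* (a :* u :* e)) refl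
               (sQ n N) (SQ N k) (ℕ→ℚ (suc k)) (SQ N (suc k)) (c ^ℚ (n ℕ.∸ N)))))
          (trans (Σ-+ (suc n) _ _) (cong (λ v → Sᶜ c n k + v) (Σ-*ˡ (suc n) (ℕ→ℚ (suc k)) _)))

-- Used to dismiss the impossible branch of expq.
1-q≡0⇒q≡1 : ∀ q → 1ℚ - q ≡ 0ℚ → q ≡ 1ℚ
1-q≡0⇒q≡1 q e = trans (solve 1 (λ q → q := con 1ℚ :- (con 1ℚ :- q)) refl q) (cong (λ w → 1ℚ - w) e)

expq-constant : ∀ q → expq q 0 ≡ 1ℚ
expq-constant q with q ≟ 1ℚ
... | yes _ = refl
... | no q≢1 with (1ℚ - q) ≟ 0ℚ
...   | yes e = ⊥-elim (q≢1 (1-q≡0⇒q≡1 q e))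
...   | no _  = refl

-- The differential equation (1 + (1-q) t) y' = y of exp_q, coefficientwise:
--   (i+1) e_{i+1} = (1 - i (1-q)) e_i.
expq-ode : ∀ q i → ℕ→ℚ (suc i) * expq q (suc i) ≡ (1ℚ - ℕ→ℚ i * (1ℚ - q)) * expq q i
expq-ode q i with q ≟ 1ℚ
... | yes refl = trans ([1+i]/[1+i]!≡1/i! i)
       (solve 2 (λ v m → v := (con 1ℚ :- m :* (con 1ℚ :- con 1ℚ)) :* v) refl (1/n! i) (ℕ→ℚ i))
... | no q≢1 with (1ℚ - q) ≟ 0ℚ
...   | yes e = ⊥-elim (q≢1 (1-q≡0⇒q≡1 q e))
...   | no c≢0 = begin
    s * ((fa * (α - m) * u) * (c * cp))
      ≡⟨ solve 7 (λ s fa α m u c cp → s :* ((fa :* (α :- m) :* u) :* (c :* cp))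
                   := (α :* c :- m :* c) :* (fa :* cp) :* (s :* u)) refl s fa α m u c cp ⟩
    (α * c - m * c) * (fa * cp) * (s * u)
      ≡⟨ cong₂ (λ w z → (w - m * c) * (fa * cp) * z) (QP.*-inverseˡ c {{Q.≢-nonZero c≢0}}) ([1+i]/[1+i]!≡1/i! i) ⟩
    (1ℚ - m * c) * (fa * cp) * v
      ≡⟨ solve 5 (λ m c fa cp v → (con 1ℚ :- m :* c) :* (fa :* cp) :* v := (con 1ℚ :- m :* c) :* (fa :* v :* cp)) refl m c fa cp v ⟩
    (1ℚ - m * c) * (fa * v * cp) ∎
  where
  open ≡-Reasoning
  c = 1ℚ - q
  α = (1/ c) {{Q.≢-nonZero c≢0}}
  s = ℕ→ℚ (suc i)
  m = ℕ→ℚ i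
  u = 1/n! (suc i)
  v = 1/n! i
  fa = fallingℚ α i
  cp = c ^ℚ i

expq-coeff : ∀ q n → expq q n * ℕ→ℚ (n !) ≡ expCoeff (1ℚ - q) n
expq-coeff q zero    = cong (_* 1ℚ) (expq-constant q)
expq-coeff q (suc n) = begin
  expq q (suc n) * ℕ→ℚ (suc n ℕ.* n !)
    ≡⟨ cong (expq q (suc n) *_) (ℕ→ℚ-homo-* (suc n) (n !)) ⟩
  expq q (suc n) * (ℕ→ℚ (suc n) * ℕ→ℚ (n !))
    ≡⟨ solve 3 (λ a b c → a :* (b :* c) := (b :* a) :* c) refl (expq q (suc n)) (ℕ→ℚ (suc n)) (ℕ→ℚ (n !)) ⟩
  (ℕ→ℚ (suc n) * expq q (suc n)) * ℕ→ℚ (n !)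
    ≡⟨ cong (_* ℕ→ℚ (n !)) (expq-ode q n) ⟩
  (1ℚ - ℕ→ℚ n * (1ℚ - q)) * expq q n * ℕ→ℚ (n !)
    ≡⟨ QP.*-assoc (1ℚ - ℕ→ℚ n * (1ℚ - q)) _ _ ⟩
  (1ℚ - ℕ→ℚ n * (1ℚ - q)) * (expq q n * ℕ→ℚ (n !))
    ≡⟨ cong ((1ℚ - ℕ→ℚ n * (1ℚ - q)) *_) (expq-coeff q n) ⟩
  expCoeff (1ℚ - q) (suc n) ∎
  where open ≡-Reasoning

D : Series → Series
D f i = ℕ→ℚ (suc i) * f (suc i)

δ : Series
δ zero    = 1ℚ
δ (suc _) = 0ℚ

⊛-as-Σ : ∀ (A B : Series) n → (A ⊛ B) n ≡ Σ (suc n) (λ i → A i * B (n ℕ.∸ i))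
⊛-as-Σ A B n = sumFrom0≡Σ (suc n) _

leibniz : ∀ (A B : Series) n →
  D (A ⊛ B) n ≡ Σ (suc n) (λ i → D A i * B (n ℕ.∸ i)) + Σ (suc n) (λ i → A i * D B (n ℕ.∸ i))
leibniz A B n = begin
  ℕ→ℚ (suc n) * (A ⊛ B) (suc n)
    ≡⟨ cong (ℕ→ℚ (suc n) *_) (⊛-as-Σ A B (suc n)) ⟩
  ℕ→ℚ (suc n) * Σ (suc (suc n)) (λ i → A i * B (suc n ℕ.∸ i))
    ≡⟨ sym (Σ-*ˡ (suc (suc n)) (ℕ→ℚ (suc n)) (λ i → A i * B (suc n ℕ.∸ i))) ⟩
  Σ (suc (suc n)) (λ i → ℕ→ℚ (suc n) * (A i * B (suc n ℕ.∸ i)))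
    ≡⟨ Σ-cong (suc (suc n)) split-weight ⟩
  Σ (suc (suc n)) (λ i → left i + right i)
    ≡⟨ Σ-+ (suc (suc n)) left right ⟩
  Σ (suc (suc n)) left + Σ (suc (suc n)) right
    ≡⟨ cong₂ _+_ (Σ-first (suc n) left) refl ⟩
  (left 0 + Σ (suc n) (λ i → D A i * B (n ℕ.∸ i))) + (Σ (suc n) right + right (suc n))
    ≡⟨ cong₂ (λ a b → (a + Σ (suc n) (λ i → D A i * B (n ℕ.∸ i))) + (Σ (suc n) right + b)) left-0 right-top ⟩
  (0ℚ + Σ (suc n) (λ i → D A i * B (n ℕ.∸ i))) + (Σ (suc n) right + 0ℚ)
    ≡⟨ cong₂ _+_ (QP.+-identityˡ (Σ (suc n) (λ i → D A i * B (n ℕ.∸ i)))) (trans (QP.+-identityʳ _) (Σ-cong (suc n) right-shift)) ⟩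
  Σ (suc n) (λ i → D A i * B (n ℕ.∸ i)) + Σ (suc n) (λ i → A i * D B (n ℕ.∸ i)) ∎
  where
  open ≡-Reasoning
  left : ℕ → ℚ
  left i = ℕ→ℚ i * A i * B (suc n ℕ.∸ i)
  right : ℕ → ℚ
  right i = A i * (ℕ→ℚ (suc n ℕ.∸ i) * B (suc n ℕ.∸ i))
  -- n + 1 = i + (n + 1 - i)
  split-weight : ∀ i → i < suc (suc n) → ℕ→ℚ (suc n) * (A i * B (suc n ℕ.∸ i)) ≡ left i + right i
  split-weight i (s≤s i≤1+n) = trans (cong (_* (A i * B (suc n ℕ.∸ i))) (ℕ→ℚ-split i (suc n) i≤1+n))
    (solve 4 (λ a b x y → (a :+ b) :* (x :* y) := a :* x :* y :+ x :* (b :* y)) refl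
      (ℕ→ℚ i) (ℕ→ℚ (suc n ℕ.∸ i)) (A i) (B (suc n ℕ.∸ i)))
  left-0 : left 0 ≡ 0ℚ
  left-0 = trans (cong (_* B (suc n)) (QP.*-zeroˡ (A 0))) (QP.*-zeroˡ (B (suc n)))
  right-top : right (suc n) ≡ 0ℚ
  right-top rewrite ℕP.n∸n≡0 n = trans (cong (A (suc n) *_) (QP.*-zeroˡ (B 0))) (QP.*-zeroʳ (A (suc n)))
  right-shift : ∀ i → i < suc n → right i ≡ A i * D B (n ℕ.∸ i)
  right-shift i (s≤s i≤n) rewrite ℕP.+-∸-assoc 1 i≤n = refl

-- Coefficients of the powers of a solution of (1 + c t) G' = G + x.

module PowersOfSolution (x c : ℚ) (G : Series) (G-constant : G 0 ≡ 0ℚ)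
                        (G-ode : ∀ i → D G i ≡ (1ℚ - ℕ→ℚ i * c) * G i + x * δ i) where

  P : ℕ → Series
  P k = G ^ˢ k

  kxP : ℕ → Series
  kxP zero    m = 0ℚ
  kxP (suc k) m = ℕ→ℚ (suc k) * x * P k m

  δ-unit : ∀ k m → Σ (suc m) (λ i → δ i * P k (m ℕ.∸ i)) ≡ P k m
  δ-unit k m = trans (Σ-first m (λ i → δ i * P k (m ℕ.∸ i)))
    (trans (cong (λ v → 1ℚ * P k m + v) (Σ-zero m (λ i _ → QP.*-zeroˡ (P k (m ℕ.∸ suc i)))))
      (trans (QP.+-identityʳ (1ℚ * P k m)) (QP.*-identityˡ (P k m))))

  G*kxP : ∀ k m → Σ (suc m) (λ i → G i * kxP k (m ℕ.∸ i)) ≡ ℕ→ℚ k * x * P k m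
  G*kxP zero    m = trans (Σ-zero (suc m) (λ i _ → QP.*-zeroʳ (G i)))
    (sym (trans (cong (_* P 0 m) (QP.*-zeroˡ x)) (QP.*-zeroˡ (P 0 m))))
  G*kxP (suc k) m =
    trans (Σ-cong′ (suc m) (λ i → solve 3 (λ g a p → g :* (a :* p) := a :* (g :* p)) refl (G i) (ℕ→ℚ (suc k) * x) (P k (m ℕ.∸ i))))
      (trans (Σ-*ˡ (suc m) (ℕ→ℚ (suc k) * x) (λ i → G i * P k (m ℕ.∸ i)))
        (cong (ℕ→ℚ (suc k) * x *_) (sym (⊛-as-Σ G (P k) m))))

  -- (1 + c t) (G^k)' = k G^{k-1} (G + x), coefficientwise:
  --   (m+1) P_k(m+1) = (k - m c) P_k(m) + k x P_{k-1}(m).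
  power-ode : ∀ k m → D (P k) m ≡ (ℕ→ℚ k - ℕ→ℚ m * c) * P k m + kxP k m
  power-ode zero zero = solve 1 (λ c → con (ℕ→ℚ 1) :* con 0ℚ := (con 0ℚ :- con 0ℚ :* c) :* con 1ℚ :+ con 0ℚ) refl c
  power-ode zero (suc m) =
    solve 3 (λ s t c → s :* con 0ℚ := (con 0ℚ :- t :* c) :* con 0ℚ :+ con 0ℚ) refl (ℕ→ℚ (suc (suc m))) (ℕ→ℚ (suc m)) c
  power-ode (suc k) m = begin
    D (G ⊛ P k) m
      ≡⟨ leibniz G (P k) m ⟩
    Σ (suc m) (λ i → D G i * P k (m ℕ.∸ i)) + Σ (suc m) (λ i → G i * D (P k) (m ℕ.∸ i))
      ≡⟨ sym (Σ-+ (suc m) _ _) ⟩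
    Σ (suc m) (λ i → D G i * P k (m ℕ.∸ i) + G i * D (P k) (m ℕ.∸ i))
      ≡⟨ Σ-cong (suc m) termwise ⟩
    Σ (suc m) (λ i → (K * (G i * P k (m ℕ.∸ i)) + x * (δ i * P k (m ℕ.∸ i))) + G i * kxP k (m ℕ.∸ i))
      ≡⟨ trans (Σ-+ (suc m) _ _) (cong (_+ Σ (suc m) (λ i → G i * kxP k (m ℕ.∸ i))) (Σ-+ (suc m) _ _)) ⟩
    (Σ (suc m) (λ i → K * (G i * P k (m ℕ.∸ i))) + Σ (suc m) (λ i → x * (δ i * P k (m ℕ.∸ i))))
      + Σ (suc m) (λ i → G i * kxP k (m ℕ.∸ i))
      ≡⟨ cong₂ _+_ (cong₂ _+_ (trans (Σ-*ˡ (suc m) K _) (cong (K *_) (sym (⊛-as-Σ G (P k) m))))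
                              (trans (Σ-*ˡ (suc m) x _) (cong (x *_) (δ-unit k m))))
                   (G*kxP k m) ⟩
    (K * P (suc k) m + x * P k m) + ℕ→ℚ k * x * P k m
      ≡⟨ solve 5 (λ K a k x p → (K :* a :+ x :* p) :+ k :* x :* p := K :* a :+ (con 1ℚ :+ k) :* x :* p) refl
           K (P (suc k) m) (ℕ→ℚ k) x (P k m) ⟩
    K * P (suc k) m + (1ℚ + ℕ→ℚ k) * x * P k m
      ≡⟨ cong (λ v → K * P (suc k) m + v * x * P k m) (sym (ℕ→ℚ-homo-+ 1 k)) ⟩
    (ℕ→ℚ (suc k) - ℕ→ℚ m * c) * P (suc k) m + kxP (suc k) m ∎
    where
    open ≡-Reasoning
    K = ℕ→ℚ (suc k) - ℕ→ℚ m * c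
    k≡[1+k]-1 : ℕ→ℚ k ≡ ℕ→ℚ (suc k) - 1ℚ
    k≡[1+k]-1 = trans (solve 1 (λ a → a := con 1ℚ :+ a :- con 1ℚ) refl (ℕ→ℚ k)) (cong (_- 1ℚ) (sym (ℕ→ℚ-homo-+ 1 k)))
    termwise : ∀ i → i < suc m → D G i * P k (m ℕ.∸ i) + G i * D (P k) (m ℕ.∸ i)
                              ≡ (K * (G i * P k (m ℕ.∸ i)) + x * (δ i * P k (m ℕ.∸ i))) + G i * kxP k (m ℕ.∸ i)
    termwise i (s≤s i≤m) = begin
      D G i * p + G i * D (P k) (m ℕ.∸ i)
        ≡⟨ cong₂ (λ a b → a * p + G i * b) (G-ode i) (power-ode k (m ℕ.∸ i)) ⟩
      ((1ℚ - Iℚ * c) * G i + x * δ i) * p + G i * ((ℕ→ℚ k - Jℚ * c) * p + z)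
        ≡⟨ cong (λ a → ((1ℚ - Iℚ * c) * G i + x * δ i) * p + G i * ((a - Jℚ * c) * p + z)) k≡[1+k]-1 ⟩
      ((1ℚ - Iℚ * c) * G i + x * δ i) * p + G i * (((ℕ→ℚ (suc k) - 1ℚ) - Jℚ * c) * p + z)
        ≡⟨ solve 9 (λ Iℚ Jℚ S c g d x p z →
              ((con 1ℚ :- Iℚ :* c) :* g :+ x :* d) :* p :+ g :* (((S :- con 1ℚ) :- Jℚ :* c) :* p :+ z)
              := ((S :- (Iℚ :+ Jℚ) :* c) :* (g :* p) :+ x :* (d :* p)) :+ g :* z) refl
             Iℚ Jℚ (ℕ→ℚ (suc k)) c (G i) (δ i) x p z ⟩
      ((ℕ→ℚ (suc k) - (Iℚ + Jℚ) * c) * (G i * p) + x * (δ i * p)) + G i * z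
        ≡⟨ cong (λ v → ((ℕ→ℚ (suc k) - v * c) * (G i * p) + x * (δ i * p)) + G i * z) (sym (ℕ→ℚ-split i m i≤m)) ⟩
      (K * (G i * p) + x * (δ i * p)) + G i * z ∎
      where
      Iℚ = ℕ→ℚ i
      Jℚ = ℕ→ℚ (m ℕ.∸ i)
      p = P k (m ℕ.∸ i)
      z = kxP k (m ℕ.∸ i)

  power-constant : ∀ k → P (suc k) 0 ≡ 0ℚ
  power-constant k = trans (⊛-as-Σ G (P k) 0)
    (trans (QP.+-identityˡ (G 0 * P k 0)) (trans (cong (_* P k 0) G-constant) (QP.*-zeroˡ (P k 0))))

  -- n! [t^n] G^k = k! x^k Sᶜ(n,k): both sides satisfy the same recurrence in (n,k).
  power-coeff : ∀ n k → ℕ→ℚ (n !) * P k n ≡ ℕ→ℚ (k !) * x ^ℚ k * Sᶜ c n k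
  power-coeff zero zero = refl
  power-coeff zero (suc k) = trans (cong (ℕ→ℚ 1 *_) (power-constant k)) (trans (QP.*-zeroʳ (ℕ→ℚ 1))
      (sym (QP.*-zeroʳ (ℕ→ℚ (suc k !) * x ^ℚ suc k))))
  power-coeff (suc n) zero = trans (QP.*-zeroʳ (ℕ→ℚ (suc n !)))
      (sym (trans (cong (ℕ→ℚ 1 * 1ℚ *_) (Sᶜ-n0 c n)) (QP.*-zeroʳ (ℕ→ℚ 1 * 1ℚ))))
  power-coeff (suc n) (suc k) = begin
    ℕ→ℚ (suc n ℕ.* n !) * P (suc k) (suc n)
      ≡⟨ cong (_* P (suc k) (suc n)) (ℕ→ℚ-homo-* (suc n) (n !)) ⟩
    ℕ→ℚ (suc n) * ℕ→ℚ (n !) * P (suc k) (suc n)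
      ≡⟨ solve 3 (λ a b c → a :* b :* c := b :* (a :* c)) refl (ℕ→ℚ (suc n)) (ℕ→ℚ (n !)) (P (suc k) (suc n)) ⟩
    ℕ→ℚ (n !) * D (P (suc k)) n
      ≡⟨ cong (ℕ→ℚ (n !) *_) (power-ode (suc k) n) ⟩
    ℕ→ℚ (n !) * ((s - m * c) * P (suc k) n + s * x * P k n)
      ≡⟨ solve 7 (λ F s m c a x b → F :* ((s :- m :* c) :* a :+ s :* x :* b) := (s :- m :* c) :* (F :* a) :+ s :* x :* (F :* b)) refl
           (ℕ→ℚ (n !)) s m c (P (suc k) n) x (P k n) ⟩
    (s - m * c) * (ℕ→ℚ (n !) * P (suc k) n) + s * x * (ℕ→ℚ (n !) * P k n)
      ≡⟨ cong₂ (λ a b → (s - m * c) * a + s * x * b) (power-coeff n (suc k)) (power-coeff n k) ⟩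
    (s - m * c) * (ℕ→ℚ (suc k ℕ.* k !) * (x * X) * Sᶜ c n (suc k)) + s * x * (f * X * Sᶜ c n k)
      ≡⟨ cong (λ v → (s - m * c) * (v * (x * X) * Sᶜ c n (suc k)) + s * x * (f * X * Sᶜ c n k)) (ℕ→ℚ-homo-* (suc k) (k !)) ⟩
    (s - m * c) * (s * f * (x * X) * Sᶜ c n (suc k)) + s * x * (f * X * Sᶜ c n k)
      ≡⟨ solve 8 (λ s m c f x X a b → (s :- m :* c) :* (s :* f :* (x :* X) :* a) :+ s :* x :* (f :* X :* b)
                   := s :* f :* (x :* X) :* (b :+ (s :- m :* c) :* a)) refl s m c f x X (Sᶜ c n (suc k)) (Sᶜ c n k) ⟩
    s * f * (x * X) * (Sᶜ c n k + (s - m * c) * Sᶜ c n (suc k))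
      ≡⟨ cong₂ (λ a b → a * (x * X) * b) (sym (ℕ→ℚ-homo-* (suc k) (k !))) (sym (Sᶜ-rec c n k)) ⟩
    ℕ→ℚ (suc k !) * x ^ℚ suc k * Sᶜ c (suc n) (suc k) ∎
    where
    open ≡-Reasoning
    s = ℕ→ℚ (suc k)
    m = ℕ→ℚ n
    f = ℕ→ℚ (k !)
    X = x ^ℚ k

-- G = x (exp_q - 1) satisfies the hypothesis of PowersOfSolution with c = 1 - q.
x[expq-1]-ode : ∀ x q (G : Series) → G 0 ≡ 0ℚ → (∀ m → G (suc m) ≡ x * expq q (suc m)) →
  ∀ i → D G i ≡ (1ℚ - ℕ→ℚ i * (1ℚ - q)) * G i + x * δ i
x[expq-1]-ode x q G G0 G-suc zero rewrite G-suc 0 | G0 =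
  trans (cong (λ v → 1ℚ * (x * v)) first-coeff)
        (solve 2 (λ x c → con 1ℚ :* (x :* con 1ℚ) := (con 1ℚ :- con 0ℚ :* c) :* con 0ℚ :+ x :* con 1ℚ) refl x (1ℚ - q))
  where
  first-coeff : expq q 1 ≡ 1ℚ
  first-coeff = trans (sym (QP.*-identityˡ (expq q 1)))
    (trans (expq-ode q 0) (trans (cong ((1ℚ - 0ℚ * (1ℚ - q)) *_) (expq-constant q))
      (solve 1 (λ c → (con 1ℚ :- con 0ℚ :* c) :* con 1ℚ := con 1ℚ) refl (1ℚ - q))))
x[expq-1]-ode x q G G0 G-suc (suc i) rewrite G-suc (suc i) | G-suc i =
  trans (solve 3 (λ s x e → s :* (x :* e) := x :* (s :* e)) refl (ℕ→ℚ (suc (suc i))) x (expq q (suc (suc i))))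
    (trans (cong (x *_) (expq-ode q (suc i)))
      (solve 3 (λ x k e → x :* (k :* e) := k :* (x :* e) :+ x :* con 0ℚ) refl x (1ℚ - ℕ→ℚ (suc i) * (1ℚ - q)) (expq q (suc i))))

-- n! [t^n] exp_p(G(t)) = Σ_{k ≤ n} k! [t^k] exp_p · (n! / k!) [t^n] G^k
--                     = Σ_{k ≤ n} Π_{j<k} (1 - j (1-p)) · x^k · Sᶜ(n,k)   with c = 1 - q.
compose-expq-coeff : ∀ x p q (G : Series) → (G0 : G 0 ≡ 0ℚ) → (∀ m → G (suc m) ≡ x * expq q (suc m)) →
  ∀ n → ℕ→ℚ (n !) * compose (expq p) G n ≡ Σ (suc n) (λ k → expCoeff (1ℚ - p) k * x ^ℚ k * Sᶜ (1ℚ - q) n k)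
compose-expq-coeff x p q G G0 G-suc n =
  trans (cong (ℕ→ℚ (n !) *_) (sumFrom0≡Σ (suc n) _))
    (trans (sym (Σ-*ˡ (suc n) (ℕ→ℚ (n !)) _)) (Σ-cong′ (suc n) term))
  where
  open PowersOfSolution x (1ℚ - q) G G0 (x[expq-1]-ode x q G G0 G-suc)
  open ≡-Reasoning
  term : ∀ k → ℕ→ℚ (n !) * (expq p k * P k n) ≡ expCoeff (1ℚ - p) k * x ^ℚ k * Sᶜ (1ℚ - q) n k
  term k = begin
    ℕ→ℚ (n !) * (expq p k * P k n)
      ≡⟨ solve 3 (λ a b c → a :* (b :* c) := b :* (a :* c)) refl (ℕ→ℚ (n !)) (expq p k) (P k n) ⟩
    expq p k * (ℕ→ℚ (n !) * P k n)
      ≡⟨ cong (expq p k *_) (power-coeff n k) ⟩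
    expq p k * (ℕ→ℚ (k !) * x ^ℚ k * Sᶜ (1ℚ - q) n k)
      ≡⟨ solve 4 (λ a b c d → a :* (b :* c :* d) := a :* b :* c :* d) refl (expq p k) (ℕ→ℚ (k !)) (x ^ℚ k) (Sᶜ (1ℚ - q) n k) ⟩
    expq p k * ℕ→ℚ (k !) * x ^ℚ k * Sᶜ (1ℚ - q) n k
      ≡⟨ cong (λ v → v * x ^ℚ k * Sᶜ (1ℚ - q) n k) (expq-coeff p k) ⟩
    expCoeff (1ℚ - p) k * x ^ℚ k * Sᶜ (1ℚ - q) n k ∎

touchard-expansion : ∀ n x p q → T n x p q ≡ Σ (suc n) (λ k → expCoeff (1ℚ - p) k * x ^ℚ k * Sᶜ (1ℚ - q) n k)
touchard-expansion n x p q = compose-expq-coeff x p q _ refl (λ _ → refl) n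

rhsSummand : ℕ → ℚ → ℚ → ℚ → ℕ → ℕ → ℕ → ℕ → ℕ → ℚ
rhsSummand n x p q k m ℓ i j =
    ℕ→ℚ (i C m) * ℕ→ℚ (j C ℓ) * ((- 1ℚ) ^ℚ (m ℕ.+ ℓ))
    * ℤ→ℚ (s₁ n (n ℕ.∸ j)) * ℕ→ℚ (S₂ (n ℕ.∸ j) k) * ℤ→ℚ (s₁ k (k ℕ.∸ i))
    * (p ^ℚ m) * (q ^ℚ ℓ) * (x ^ℚ k)

pFactor : ℚ → ℕ → ℕ → ℕ → ℚ
pFactor p k m i = ℕ→ℚ (i C m) * ((- 1ℚ) ^ℚ m * p ^ℚ m) * sQ k (k ℕ.∸ i)

qFactor : ℚ → ℕ → ℕ → ℕ → ℕ → ℚ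
qFactor q n k ℓ j = ℕ→ℚ (j C ℓ) * ((- 1ℚ) ^ℚ ℓ * q ^ℚ ℓ) * (sQ n (n ℕ.∸ j) * SQ (n ℕ.∸ j) k)

rhsSummand-factors : ∀ n x p q k m ℓ i j → rhsSummand n x p q k m ℓ i j ≡ (pFactor p k m i * qFactor q n k ℓ j) * x ^ℚ k
rhsSummand-factors n x p q k m ℓ i j rewrite ^-+ (- 1ℚ) m ℓ =
  solve 10 (λ ci cj a b s1 S s2 pm ql xk →
     ci :* cj :* (a :* b) :* s1 :* S :* s2 :* pm :* ql :* xk := (ci :* (a :* pm) :* s2 :* (cj :* (b :* ql) :* (s1 :* S))) :* xk) refl
     (ℕ→ℚ (i C m)) (ℕ→ℚ (j C ℓ)) ((- 1ℚ) ^ℚ m) ((- 1ℚ) ^ℚ ℓ) (sQ n (n ℕ.∸ j)) (SQ (n ℕ.∸ j) k) (sQ k (k ℕ.∸ i))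
     (p ^ℚ m) (q ^ℚ ℓ) (x ^ℚ k)

Σ-separate : ∀ L I (J : ℕ → ℕ) (a : ℕ → ℚ) (b : ℕ → ℕ → ℚ) X →
  Σ L (λ ℓ → Σ I (λ i → Σ (J ℓ) (λ j → (a i * b ℓ j) * X))) ≡ Σ I a * X * Σ L (λ ℓ → Σ (J ℓ) (b ℓ))
Σ-separate L I J a b X =
  trans (Σ-cong′ L (λ ℓ → trans (Σ-cong′ I (λ i →
      trans (Σ-cong′ (J ℓ) (λ j → solve 3 (λ a b X → (a :* b) :* X := (a :* X) :* b) refl (a i) (b ℓ j) X))
            (Σ-*ˡ (J ℓ) (a i * X) (b ℓ))))
      (trans (Σ-*ʳ I (Σ (J ℓ) (b ℓ)) (λ i → a i * X)) (cong (_* Σ (J ℓ) (b ℓ)) (Σ-*ʳ I X a)))))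
    (Σ-*ˡ L (Σ I a * X) (λ ℓ → Σ (J ℓ) (b ℓ)))

pSum : ℚ → ℕ → ℚ
pSum p k = Σ k (λ m → Σ (k ℕ.∸ m) (λ t → pFactor p k m (m ℕ.+ t)))

qSum : ℚ → ℕ → ℕ → ℚ
qSum q n k = Σ (suc (n ℕ.∸ k)) (λ ℓ → Σ (suc (n ℕ.∸ k) ℕ.∸ ℓ) (λ t → qFactor q n k ℓ (ℓ ℕ.+ t)))

rhs-factorised : ∀ n x p q → rhs n x p q ≡ Σ (suc n) (λ k → pSum p k * x ^ℚ k * qSum q n k)
rhs-factorised n x p q = trans (sumFrom0≡Σ (suc n) _) (Σ-cong′ (suc n) term)
  where
  term : ∀ k → _ ≡ pSum p k * x ^ℚ k * qSum q n k
  term k = begin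
    _ ≡⟨ trans (sumFrom0≡Σ k _) (Σ-cong′ k (λ m → trans (sumFrom0≡Σ (suc N) _) (Σ-cong′ (suc N) (λ ℓ →
            trans (sumFrom≡Σ-shifted m k _) (Σ-cong′ (k ℕ.∸ m) (λ t → sumFrom≡Σ-shifted ℓ (suc N) _)))))) ⟩
    Σ k (λ m → Σ (suc N) (λ ℓ → Σ (k ℕ.∸ m) (λ t → Σ (suc N ℕ.∸ ℓ) (λ u →
      rhsSummand n x p q k m ℓ (m ℕ.+ t) (ℓ ℕ.+ u)))))
      ≡⟨ Σ-cong′ k (λ m → Σ-cong′ (suc N) (λ ℓ → Σ-cong′ (k ℕ.∸ m) (λ t → Σ-cong′ (suc N ℕ.∸ ℓ) (λ u →
            rhsSummand-factors n x p q k m ℓ (m ℕ.+ t) (ℓ ℕ.+ u))))) ⟩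
    Σ k (λ m → Σ (suc N) (λ ℓ → Σ (k ℕ.∸ m) (λ t → Σ (suc N ℕ.∸ ℓ) (λ u →
      (pFactor p k m (m ℕ.+ t) * qFactor q n k ℓ (ℓ ℕ.+ u)) * x ^ℚ k))))
      ≡⟨ Σ-cong′ k (λ m → Σ-separate (suc N) (k ℕ.∸ m) (λ ℓ → suc N ℕ.∸ ℓ)
            (λ t → pFactor p k m (m ℕ.+ t)) (λ ℓ u → qFactor q n k ℓ (ℓ ℕ.+ u)) (x ^ℚ k)) ⟩
    Σ k (λ m → Σ (k ℕ.∸ m) (λ t → pFactor p k m (m ℕ.+ t)) * x ^ℚ k * qSum q n k)
      ≡⟨ trans (Σ-*ʳ k (qSum q n k) _) (cong (_* qSum q n k) (Σ-*ʳ k (x ^ℚ k) _)) ⟩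
    pSum p k * x ^ℚ k * qSum q n k ∎
    where
    open ≡-Reasoning
    N = n ℕ.∸ k

-- For k ≥ 1:  pSum p k = Σ_{i<k} (1-p)^i s(k,k-i) = Σ_{N ≥ 1} s(k,N) (1-p)^{k-N}
--                      = sTransform (1-p) k 1 = Π_{j<k} (1 - j (1-p)).
pSum-value : ∀ p k → pSum p (suc k) ≡ expCoeff (1ℚ - p) (suc k)
pSum-value p k = begin
  pSum p K
    ≡⟨ Σ-triangle K (pFactor p K) ⟩
  Σ K (λ i → Σ (suc i) (λ m → pFactor p K m i))
    ≡⟨ Σ-cong′ K (λ i → alternating-binomial i p (sQ K (K ℕ.∸ i))) ⟩
  Σ K (λ i → a ^ℚ i * sQ K (K ℕ.∸ i))
    ≡⟨ Σ-reverse K _ ⟩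
  Σ K (λ N → a ^ℚ (K ℕ.∸ suc N) * sQ K (K ℕ.∸ (K ℕ.∸ suc N)))
    ≡⟨ Σ-cong K reindex ⟩
  Σ K (λ N → sQ K (suc N) * 1ℚ * a ^ℚ (K ℕ.∸ suc N))
    ≡⟨ sym (trans (Σ-first K _) (trans (cong (_+ Σ K (λ N → sQ K (suc N) * 1ℚ * a ^ℚ (K ℕ.∸ suc N))) N0-term)
                                       (QP.+-identityˡ _))) ⟩
  sTransform a K (λ _ → 1ℚ)
    ≡⟨ sTransform-one a K ⟩
  expCoeff a K ∎
  where
  open ≡-Reasoning
  K = suc k
  a = 1ℚ - p
  reindex : ∀ N → N < K → a ^ℚ (K ℕ.∸ suc N) * sQ K (K ℕ.∸ (K ℕ.∸ suc N)) ≡ sQ K (suc N) * 1ℚ * a ^ℚ (K ℕ.∸ suc N)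
  reindex N N<K rewrite ℕP.m∸[m∸n]≡n N<K =
    solve 2 (λ x y → x :* y := y :* con 1ℚ :* x) refl (a ^ℚ (K ℕ.∸ suc N)) (sQ K (suc N))
  N0-term : sQ K 0 * 1ℚ * a ^ℚ K ≡ 0ℚ
  N0-term = QP.*-zeroˡ (a ^ℚ K)

-- An index beyond n - k gives n - j < k, where S(n-j, k) vanishes.
n∸[1+[n∸k]+t]<k : ∀ n k t → k ≤ n → t < k → n ℕ.∸ (suc (n ℕ.∸ k) ℕ.+ t) < k
n∸[1+[n∸k]+t]<k n (suc k) t k≤n t<k = subst (_< suc k) (sym n∸[1+[n∸k]+t]≡k∸t) (s≤s (ℕP.m∸n≤m k t))
  where
  n∸[1+[n∸k]+t]≡k∸t : n ℕ.∸ (suc (n ℕ.∸ suc k) ℕ.+ t) ≡ suc k ℕ.∸ suc t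
  n∸[1+[n∸k]+t]≡k∸t = trans (cong (n ℕ.∸_) (sym (ℕP.+-suc (n ℕ.∸ suc k) t)))
    (trans (sym (ℕP.∸-+-assoc n (n ℕ.∸ suc k) (suc t))) (cong (ℕ._∸ suc t) (ℕP.m∸[m∸n]≡n k≤n)))

-- For k ≤ n:  qSum q n k = Σ_{j ≤ n-k} (1-q)^j s(n,n-j) S(n-j,k) = Sᶜ(n,k) with c = 1 - q,
-- the terms with j > n - k being zero.
qSum-value : ∀ q n k → k ≤ n → qSum q n k ≡ Sᶜ (1ℚ - q) n k
qSum-value q n k k≤n = begin
  qSum q n k
    ≡⟨ Σ-triangle L (qFactor q n k) ⟩
  Σ L (λ j → Σ (suc j) (λ ℓ → qFactor q n k ℓ j))
    ≡⟨ Σ-cong′ L (λ j → alternating-binomial j q (sQ n (n ℕ.∸ j) * SQ (n ℕ.∸ j) k)) ⟩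
  Σ L g
    ≡⟨ sym (QP.+-identityʳ _) ⟩
  Σ L g + 0ℚ
    ≡⟨ cong (λ w → Σ L g + w) (sym (Σ-zero k beyond-vanishes)) ⟩
  Σ L g + Σ k (λ t → g (L ℕ.+ t))
    ≡⟨ sym (Σ-split L k g) ⟩
  Σ (L ℕ.+ k) g
    ≡⟨ cong (λ z → Σ z g) (cong suc (ℕP.m∸n+n≡m k≤n)) ⟩
  Σ (suc n) g
    ≡⟨ Σ-reverse (suc n) g ⟩
  Σ (suc n) (λ N → g (n ℕ.∸ N))
    ≡⟨ Σ-cong (suc n) reindex ⟩
  Sᶜ c n k ∎
  where
  open ≡-Reasoning
  L = suc (n ℕ.∸ k)
  c = 1ℚ - q
  g : ℕ → ℚ
  g j = c ^ℚ j * (sQ n (n ℕ.∸ j) * SQ (n ℕ.∸ j) k)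
  beyond-vanishes : ∀ t → t < k → g (L ℕ.+ t) ≡ 0ℚ
  beyond-vanishes t t<k rewrite S₂-vanishes (n ℕ.∸ (L ℕ.+ t)) k (n∸[1+[n∸k]+t]<k n k t k≤n t<k) =
    trans (cong (c ^ℚ (L ℕ.+ t) *_) (QP.*-zeroʳ (sQ n (n ℕ.∸ (L ℕ.+ t))))) (QP.*-zeroʳ (c ^ℚ (L ℕ.+ t)))
  reindex : ∀ N → N < suc n → g (n ℕ.∸ N) ≡ sQ n N * SQ N k * c ^ℚ (n ℕ.∸ N)
  reindex N (s≤s N≤n) rewrite ℕP.m∸[m∸n]≡n N≤n =
    solve 3 (λ a b d → a :* (b :* d) := b :* d :* a) refl (c ^ℚ (n ℕ.∸ N)) (sQ n N) (SQ N k)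

-- Both sides are Σ_{k ≤ n} (…) x^k; compare term by term.  For k = 0 both terms
-- vanish (Sᶜ(n,0) = 0 as n ≥ 1, and pSum p 0 is an empty sum); for k ≥ 1 the
-- factors agree by pSum-value and qSum-value.
mainTheorem6 : (n : ℕ) → 1 ≤ n → (x p q : ℚ) → T n x p q ≡ rhs n x p q
mainTheorem6 (suc n) _ x p q =
  trans (touchard-expansion (suc n) x p q)
    (trans (Σ-cong (suc (suc n)) same-term) (sym (rhs-factorised (suc n) x p q)))
  where
  same-term : ∀ k → k < suc (suc n) →
    expCoeff (1ℚ - p) k * x ^ℚ k * Sᶜ (1ℚ - q) (suc n) k ≡ pSum p k * x ^ℚ k * qSum q (suc n) k
  same-term zero _ =
    trans (trans (cong (1ℚ * 1ℚ *_) (Sᶜ-n0 (1ℚ - q) n)) (QP.*-zeroʳ (1ℚ * 1ℚ)))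
          (sym (trans (cong (_* qSum q (suc n) 0) (QP.*-zeroˡ 1ℚ)) (QP.*-zeroˡ (qSum q (suc n) 0))))
  same-term (suc k) (s≤s k≤n) =
    cong₂ (λ a b → a * x ^ℚ suc k * b) (sym (pSum-value p k)) (sym (qSum-value q (suc n) (suc k) k≤n))
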